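{- For every positive integer $n$, $$\prod_{i=1}^{n-1}(2i-1)\;\le\;T(1^n)\;\le\;2^{\binom{n-2}{2}-1}\cdot 3^n,$$ where $\binom{n-2}{2}=(n-2)(n-3)/2$.
   Context: Let $U_n$ be the set of $n\times n$ upper-triangular matrices with nonnegative integer entries. For $A=(a_{i,j})\in U_n$, the $k$-th hook sum is $h_k=(a_{k,k}+\cdots+a_{k,n})-(a_{1,k}+\cdots+a_{k-1,k})$. A Tesler matrix is one with $h_k=1$ for all $1\le k\le n$, and $T(1^n)$ is the number of $n\times n$ Tesler matrices. -}

module Defs where

open import Data.Nat using (ℕ; zero; suc; _+_; _*_; _∸_; _/_; _≡ᵇ_)
open import Data.Integer as ℤ using (ℤ; +_; ∣_∣)
open import Data.Fin using (Fin; _<?_; _≤?_) renaming (zero to fzero; suc to fsuc)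
open import Data.Vec using (Vec; lookup)
open import Data.List using (List; length)
open import Data.List.Membership.Propositional using (_∈_)
open import Data.List.Relation.Unary.Unique.Propositional using (Unique)
open import Data.Product using (Σ; _×_)
open import Relation.Nullary.Decidable using (does)
open import Data.Bool using (if_then_else_)
open import Relation.Binary.PropositionalEquality using (_≡_)

Matrix : ℕ → Set
Matrix n = Vec (Vec ℕ n) n

entry : ∀ {n} → Matrix n → Fin n → Fin n → ℕ
entry A i j = lookup (lookup A i) j

ΣFin : ∀ n → (Fin n → ℕ) → ℕ
ΣFin zero    f = 0
ΣFin (suc n) f = f fzero + ΣFin n (λ i → f (fsuc i))

UpperTriangular : ∀ {n} → Matrix n → Set
UpperTriangular {n} A = ∀ (i j : Fin n) → Data.Fin._<_ j i → entry A i j ≡ 0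

rowPart : ∀ {n} → Matrix n → Fin n → ℕ
rowPart {n} A k = ΣFin n (λ j → if does (k ≤? j) then entry A k j else 0)

colPart : ∀ {n} → Matrix n → Fin n → ℕ
colPart {n} A k = ΣFin n (λ i → if does (i <? k) then entry A i k else 0)

-- hook sum h_k = rowPart - colPart equals 1, i.e. rowPart = 1 + colPart (in ℕ)
IsTesler : ∀ {n} → Matrix n → Set
IsTesler {n} A = UpperTriangular A × (∀ (k : Fin n) → rowPart A k ≡ 1 + colPart A k)

TeslerCount : ℕ → ℕ → Set
TeslerCount n t =
  Σ (List (Matrix n)) λ L →
    Unique L × (∀ (A : Matrix n) → (A ∈ L → IsTesler A) × (IsTesler A → A ∈ L))
             × length L ≡ t

oddProd : ℕ → ℕ
oddProd zero    = 1
oddProd (suc m) = oddProd m * (2 * m + 1)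

-- binom(n-2, 2) = (n-2)(n-3)/2, computed over ℤ (nonnegative for all n)
binom2' : ℕ → ℕ
binom2' n = ∣ (+ n ℤ.- + 2) ℤ.* (+ n ℤ.- + 3) ∣ / 2

-- We work with Tesler matrices for an arbitrary hook vector h ∈ ℕⁿ.  Removing the
-- first row r of such a matrix leaves a Tesler matrix for (h₂ + r₂, …, hₙ + rₙ), and r
-- ranges over the weak compositions of h₁ into n parts.  This yields a duplicate-free
-- enumeration whose length T h satisfies
--   T (h₁, …, hₙ) = Σ_r T (h₂ + r₂, …, hₙ + rₙ),
-- and both bounds follow from this recursion by induction on n:
--  * lower bound: T (x+1, b) ≥ (2k+1)!! · K (k+1) x for every positive b of length k+1,
--    where K m x = binom(x+m-1, m-1) counts compositions; the step uses a
--    Vandermonde-type convolution and the inequality M · K j x ≤ K M (x+1) (2j ≤ M+1);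
--  * upper bound: T v · λ^(1,…,1) ≤ A₀ ⋯ A_{m-1} · λ^v for explicit weights λ_k, A_k,
--    driven by λ_k (A_k + A_{k+1}) ≤ A_{k+1} λ_{k+1}; the product A₀ ⋯ A_{n-1} is then
--    estimated numerically.
module Submission where

open import Defs
open import Data.Nat using (ℕ; _+_; _*_; _∸_; _^_; _≤_)
open import Data.Product using (∃-syntax; _×_)

open import Data.Nat using (zero; suc; z≤n; s≤s; s≤s⁻¹; NonZero; >-nonZero; _/_)
open import Data.Nat.Properties hiding (_≤?_; _<?_)
open import Data.Nat.DivMod using (m*n/n≡m)
open import Data.Nat.Tactic.RingSolver using (solve-∀)
open import Data.Integer.Properties using (abs-◃)
import Data.Sign as Sign
open import Data.Product using (_,_; proj₁; proj₂)
open import Data.Unit using (tt)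
open import Data.Empty using (⊥)
open import Data.Sum using (inj₁; inj₂)
open import Data.Bool using (if_then_else_)
open import Data.List using (List; []; _∷_; _++_; map; length; [_]; concatMap)
open import Data.List.Properties using (length-map; length-++)
open import Data.List.Membership.Propositional using (_∈_; find; lose)
open import Data.List.Membership.Propositional.Properties
  using (∈-map⁺; ∈-map⁻; ∈-++⁺ˡ; ∈-++⁺ʳ; ∈-++⁻; ∈-concatMap⁺; ∈-concatMap⁻)
open import Data.List.Relation.Unary.Any using (here; there)
import Data.List.Relation.Unary.All as ListAll
import Data.List.Relation.Unary.All.Properties as ListAll
open import Data.List.Relation.Unary.AllPairs as AllPairs using ([]; _∷_)
import Data.List.Relation.Unary.AllPairs.Properties as AllPairs
open import Data.List.Relation.Binary.Disjoint.Propositional using (Disjoint)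
open import Data.List.Relation.Unary.Unique.Propositional using (Unique)
import Data.List.Relation.Unary.Unique.Propositional.Properties as Unique
open import Data.Vec as Vec using (Vec; []; _∷_; head; tail; zipWith; lookup; replicate)
open import Data.Vec.Properties using (lookup-map; lookup-zipWith; lookup-replicate)
open import Data.Vec.Relation.Unary.All using (All; []; _∷_)
open import Data.Fin using (Fin; _<?_; _≤?_) renaming (zero to fzero; suc to fsuc)
open import Relation.Nullary.Decidable using (does; does-⇔)
open import Relation.Binary.PropositionalEquality hiding ([_])
open import Function using (_∘_; mk⇔)

sumL : ∀ {A : Set} → (A → ℕ) → List A → ℕ
sumL f []       = 0
sumL f (x ∷ xs) = f x + sumL f xs

sumL-++ : ∀ {A : Set} (f : A → ℕ) (xs ys : List A) →
          sumL f (xs ++ ys) ≡ sumL f xs + sumL f ys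
sumL-++ f []       ys = refl
sumL-++ f (x ∷ xs) ys = trans (cong (f x +_) (sumL-++ f xs ys)) (sym (+-assoc (f x) _ _))

sumL-map : ∀ {A B : Set} (f : B → ℕ) (g : A → B) (xs : List A) →
           sumL f (map g xs) ≡ sumL (f ∘ g) xs
sumL-map f g []       = refl
sumL-map f g (x ∷ xs) = cong (f (g x) +_) (sumL-map f g xs)

sumL-cong : ∀ {A : Set} {f g : A → ℕ} → (∀ x → f x ≡ g x) → (xs : List A) →
            sumL f xs ≡ sumL g xs
sumL-cong e []       = refl
sumL-cong e (x ∷ xs) = cong₂ _+_ (e x) (sumL-cong e xs)

sumL-mono : ∀ {A : Set} {f g : A → ℕ} → (∀ x → f x ≤ g x) → (xs : List A) →
            sumL f xs ≤ sumL g xs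
sumL-mono e []       = z≤n
sumL-mono e (x ∷ xs) = +-mono-≤ (e x) (sumL-mono e xs)

sumL-+ : ∀ {A : Set} (f g : A → ℕ) (xs : List A) →
         sumL (λ x → f x + g x) xs ≡ sumL f xs + sumL g xs
sumL-+ f g []       = refl
sumL-+ f g (x ∷ xs) = trans (cong (f x + g x +_) (sumL-+ f g xs))
                            (+-swap (f x) (g x) (sumL f xs) (sumL g xs))
  where
    +-swap : ∀ a b c d → a + b + (c + d) ≡ a + c + (b + d)
    +-swap = solve-∀

sumL-*ˡ : ∀ {A : Set} (c : ℕ) (f : A → ℕ) (xs : List A) →
          sumL (λ x → c * f x) xs ≡ c * sumL f xs
sumL-*ˡ c f []       = sym (*-zeroʳ c)
sumL-*ˡ c f (x ∷ xs) = trans (cong (c * f x +_) (sumL-*ˡ c f xs))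
                             (sym (*-distribˡ-+ c (f x) (sumL f xs)))

sumL-const : ∀ {A : Set} (c : ℕ) (xs : List A) → sumL (λ _ → c) xs ≡ length xs * c
sumL-const c []       = refl
sumL-const c (x ∷ xs) = cong (c +_) (sumL-const c xs)

sumL-≥-member : ∀ {A : Set} (f : A → ℕ) {x : A} {xs : List A} → x ∈ xs → f x ≤ sumL f xs
sumL-≥-member f {xs = y ∷ ys} (here refl) = m≤m+n (f y) (sumL f ys)
sumL-≥-member f {xs = y ∷ ys} (there x∈)  = ≤-trans (sumL-≥-member f x∈) (m≤n+m _ (f y))

-- Weak compositions.  comps m x lists every c ∈ ℕᵐ with entries summing to x,
-- each exactly once; K m x = binom(x + m - 1, m - 1) is their number.

vsum : ∀ {m} → Vec ℕ m → ℕ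
vsum []      = 0
vsum (a ∷ v) = a + vsum v

bump : ∀ {m} → Vec ℕ (suc m) → Vec ℕ (suc m)
bump (a ∷ v) = suc a ∷ v

-- a composition of x+1 either starts with 0, or is the bump of a composition of x
comps : (m : ℕ) → ℕ → List (Vec ℕ m)
comps zero    zero    = [ [] ]
comps zero    (suc x) = []
comps (suc m) zero    = map (0 ∷_) (comps m zero)
comps (suc m) (suc x) = map (0 ∷_) (comps m (suc x)) ++ map bump (comps (suc m) x)

K : ℕ → ℕ → ℕ
K zero    zero    = 1
K zero    (suc x) = 0
K (suc m) zero    = K m zero
K (suc m) (suc x) = K m (suc x) + K (suc m) x

K-zeroʳ : ∀ m → K m 0 ≡ 1
K-zeroʳ zero    = refl
K-zeroʳ (suc m) = K-zeroʳ m

K-oneʳ : ∀ m → K m 1 ≡ m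
K-oneʳ zero    = refl
K-oneʳ (suc m) = trans (cong₂ _+_ (K-oneʳ m) (K-zeroʳ m)) (+-comm m 1)

K-oneˡ : ∀ x → K 1 x ≡ 1
K-oneˡ zero    = refl
K-oneˡ (suc x) = K-oneˡ x

K-monoʳ : ∀ m x y → K (suc m) x ≤ K (suc m) (y + x)
K-monoʳ m x zero    = ≤-refl
K-monoʳ m x (suc y) = ≤-trans (K-monoʳ m x y) (m≤n+m _ (K m (suc (y + x))))

length-comps : ∀ m x → length (comps m x) ≡ K m x
length-comps zero    zero    = refl
length-comps zero    (suc x) = refl
length-comps (suc m) zero    = trans (length-map _ (comps m zero)) (length-comps m zero)
length-comps (suc m) (suc x) = begin
    length (map (0 ∷_) (comps m (suc x)) ++ map bump (comps (suc m) x))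
  ≡⟨ length-++ (map (0 ∷_) (comps m (suc x))) ⟩
    length (map (0 ∷_) (comps m (suc x))) + length (map bump (comps (suc m) x))
  ≡⟨ cong₂ _+_ (length-map _ (comps m (suc x))) (length-map _ (comps (suc m) x)) ⟩
    length (comps m (suc x)) + length (comps (suc m) x)
  ≡⟨ cong₂ _+_ (length-comps m (suc x)) (length-comps (suc m) x) ⟩
    K m (suc x) + K (suc m) x ∎
  where open ≡-Reasoning

comps-zero : ∀ m → comps m 0 ≡ [ replicate m 0 ]
comps-zero zero    = refl
comps-zero (suc m) = cong (map (0 ∷_)) (comps-zero m)

head-bump : ∀ {m} (c : Vec ℕ (suc m)) → head (bump c) ≡ suc (head c)
head-bump (a ∷ c) = refl

tail-bump : ∀ {m} (c : Vec ℕ (suc m)) → tail (bump c) ≡ tail c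
tail-bump (a ∷ c) = refl

sum-comps-zero : ∀ {m} (f : Vec ℕ m → ℕ) → sumL f (comps m 0) ≡ f (replicate m 0) + 0
sum-comps-zero {m} f = cong (sumL f) (comps-zero m)

sum-comps-suc : ∀ {m} (f : Vec ℕ (suc m) → ℕ) x →
  sumL f (comps (suc m) (suc x)) ≡ sumL (f ∘ (0 ∷_)) (comps m (suc x)) + sumL (f ∘ bump) (comps (suc m) x)
sum-comps-suc {m} f x =
  trans (sumL-++ f (map (0 ∷_) (comps m (suc x))) _)
        (cong₂ _+_ (sumL-map f (0 ∷_) (comps m (suc x))) (sumL-map f bump (comps (suc m) x)))

comps-sound : ∀ m x {c} → c ∈ comps m x → vsum c ≡ x
comps-sound zero    zero    (here refl) = refl
comps-sound (suc m) zero    c∈ with ∈-map⁻ (0 ∷_) c∈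
... | c , c∈′ , refl = comps-sound m zero c∈′
comps-sound (suc m) (suc x) c∈ with ∈-++⁻ (map (0 ∷_) (comps m (suc x))) c∈
... | inj₁ c∈₀ with ∈-map⁻ (0 ∷_) c∈₀
...   | c , c∈′ , refl = comps-sound m (suc x) c∈′
comps-sound (suc m) (suc x) c∈ | inj₂ c∈₁ with ∈-map⁻ bump c∈₁
...   | a ∷ c , c∈′ , refl = cong suc (comps-sound (suc m) x c∈′)

comps-complete : ∀ m x (c : Vec ℕ m) → vsum c ≡ x → c ∈ comps m x
comps-complete zero    zero    []          e = here refl
comps-complete (suc m) zero    (zero ∷ c)  e = ∈-map⁺ (0 ∷_) (comps-complete m zero c e)
comps-complete (suc m) (suc x) (zero ∷ c)  e = ∈-++⁺ˡ (∈-map⁺ (0 ∷_) (comps-complete m (suc x) c e))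
comps-complete (suc m) (suc x) (suc a ∷ c) e =
  ∈-++⁺ʳ (map (0 ∷_) (comps m (suc x))) (∈-map⁺ bump (comps-complete (suc m) x (a ∷ c) (suc-injective e)))

comps-unique : ∀ m x → Unique (comps m x)
comps-unique zero    zero    = ListAll.[] ∷ []
comps-unique zero    (suc x) = []
comps-unique (suc m) zero    = Unique.map⁺ cons-injective (comps-unique m zero)
  where cons-injective : ∀ {u v : Vec ℕ m} → (0 ∷ u) ≡ (0 ∷ v) → u ≡ v
        cons-injective refl = refl
comps-unique (suc m) (suc x) =
  Unique.++⁺ (Unique.map⁺ cons-injective (comps-unique m (suc x)))
             (Unique.map⁺ bump-injective (comps-unique (suc m) x)) disjoint
  where
    cons-injective : ∀ {u v : Vec ℕ m} → (0 ∷ u) ≡ (0 ∷ v) → u ≡ v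
    cons-injective refl = refl
    bump-injective : ∀ {u v : Vec ℕ (suc m)} → bump u ≡ bump v → u ≡ v
    bump-injective {_ ∷ _} {_ ∷ _} refl = refl
    -- the first part distinguishes the two halves
    disjoint : ∀ {v} → v ∈ map (0 ∷_) (comps m (suc x)) × v ∈ map bump (comps (suc m) x) → ⊥
    disjoint (p , q) with ∈-map⁻ (0 ∷_) p | ∈-map⁻ bump q
    ... | _ , _ , refl | _ ∷ _ , _ , ()

K-ratioˣ : ∀ m x → suc x * K m (suc x) ≡ (x + m) * K m x
K-ratioᵐ : ∀ m x → m * K (suc m) x ≡ (x + m) * K m x

K-ratioˣ zero    x = trans (*-zeroʳ (suc x)) (K-ratioᵐ zero x)
K-ratioˣ (suc m) x = begin
    suc x * (K m (suc x) + K (suc m) x)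
  ≡⟨ *-distribˡ-+ (suc x) (K m (suc x)) (K (suc m) x) ⟩
    suc x * K m (suc x) + suc x * K (suc m) x
  ≡⟨ cong (_+ suc x * K (suc m) x) (trans (K-ratioˣ m x) (sym (K-ratioᵐ m x))) ⟩
    m * K (suc m) x + suc x * K (suc m) x
  ≡⟨ sym (*-distribʳ-+ (K (suc m) x) m (suc x)) ⟩
    (m + suc x) * K (suc m) x
  ≡⟨ cong (_* K (suc m) x) (trans (+-comm m (suc x)) (sym (+-suc x m))) ⟩
    (x + suc m) * K (suc m) x ∎
  where open ≡-Reasoning

K-ratioᵐ zero    zero    = refl
K-ratioᵐ zero    (suc x) = sym (*-zeroʳ (suc x + 0))
K-ratioᵐ (suc m) zero    = refl
K-ratioᵐ (suc m) (suc x) = begin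
    suc m * (K (suc m) (suc x) + K (suc (suc m)) x)
  ≡⟨ *-distribˡ-+ (suc m) (K (suc m) (suc x)) (K (suc (suc m)) x) ⟩
    suc m * K (suc m) (suc x) + suc m * K (suc (suc m)) x
  ≡⟨ cong (suc m * K (suc m) (suc x) +_) (trans (K-ratioᵐ (suc m) x) (sym (K-ratioˣ (suc m) x))) ⟩
    suc m * K (suc m) (suc x) + suc x * K (suc m) (suc x)
  ≡⟨ sym (*-distribʳ-+ (K (suc m) (suc x)) (suc m) (suc x)) ⟩
    (suc m + suc x) * K (suc m) (suc x)
  ≡⟨ cong (_* K (suc m) (suc x)) (+-comm (suc m) (suc x)) ⟩
    (suc x + suc m) * K (suc m) (suc x) ∎
  where open ≡-Reasoning

-- Comparison: if j ≤ M and 2j ≤ M + 1 then M · K j x ≤ K M (x + 1).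
-- By induction on x, comparing the x-ratios (x+j)/(x+1) and (x+1+M)/(x+2).
ratio-inequality : ∀ x j M → j ≤ M → 2 * j ≤ suc M →
                   suc (suc x) * (x + j) ≤ suc x * (suc x + M)
ratio-inequality x j M j≤M 2j≤ = begin
    suc (suc x) * (x + j)
  ≡⟨ expandˡ x j ⟩
    x * x + 2 * x + (x * j + 2 * j)
  ≤⟨ +-monoʳ-≤ (x * x + 2 * x) (+-mono-≤ (*-monoʳ-≤ x j≤M) 2j≤) ⟩
    x * x + 2 * x + (x * M + suc M)
  ≡⟨ expandʳ x M ⟩
    suc x * (suc x + M) ∎
  where
    open ≤-Reasoning
    expandˡ : ∀ x j → suc (suc x) * (x + j) ≡ x * x + 2 * x + (x * j + 2 * j)
    expandˡ = solve-∀
    expandʳ : ∀ x M → x * x + 2 * x + (x * M + suc M) ≡ suc x * (suc x + M)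
    expandʳ = solve-∀

K-comparison : ∀ M j → j ≤ M → 2 * j ≤ suc M → ∀ x → M * K j x ≤ K M (suc x)
K-comparison M j j≤M 2j≤ zero    = ≤-reflexive (trans (cong (M *_) (K-zeroʳ j))
                                              (trans (*-identityʳ M) (sym (K-oneʳ M))))
K-comparison M j j≤M 2j≤ (suc x) = *-cancelˡ-≤ (suc x * suc (suc x)) scaled
  where
    scaled : suc x * suc (suc x) * (M * K j (suc x)) ≤ suc x * suc (suc x) * K M (suc (suc x))
    scaled = begin
        suc x * suc (suc x) * (M * K j (suc x))
      ≡⟨ regroupˡ (suc x) (suc (suc x)) M (K j (suc x)) ⟩
        suc (suc x) * M * (suc x * K j (suc x))
      ≡⟨ cong (suc (suc x) * M *_) (K-ratioˣ j x) ⟩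
        suc (suc x) * M * ((x + j) * K j x)
      ≡⟨ regroupʳ (suc (suc x)) M (x + j) (K j x) ⟩
        suc (suc x) * (x + j) * (M * K j x)
      ≤⟨ *-mono-≤ (ratio-inequality x j M j≤M 2j≤) (K-comparison M j j≤M 2j≤ x) ⟩
        suc x * (suc x + M) * K M (suc x)
      ≡⟨ *-assoc (suc x) (suc x + M) (K M (suc x)) ⟩
        suc x * ((suc x + M) * K M (suc x))
      ≡⟨ cong (suc x *_) (sym (K-ratioˣ M (suc x))) ⟩
        suc x * (suc (suc x) * K M (suc (suc x)))
      ≡⟨ sym (*-assoc (suc x) (suc (suc x)) (K M (suc (suc x)))) ⟩
        suc x * suc (suc x) * K M (suc (suc x)) ∎
      where
        open ≤-Reasoning
        regroupˡ : ∀ a b c d → a * b * (c * d) ≡ b * c * (a * d)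
        regroupˡ = solve-∀
        regroupʳ : ∀ a b c d → a * b * (c * d) ≡ (a * c) * (b * d)
        regroupʳ = solve-∀

sum-K-head : ∀ p m x → sumL (K p ∘ head) (comps (suc m) x) ≡ K (p + m) x
sum-K-head p m zero    = trans (sum-comps-zero {suc m} (K p ∘ head))
                               (trans (cong (_+ 0) (K-zeroʳ p)) (sym (K-zeroʳ (p + m))))
sum-K-head p m (suc x) = trans (first-part-split p) (combine p)
  where
    shifted : ℕ → ℕ
    shifted p = sumL (λ c → K p (suc (head c))) (comps (suc m) x)

    first-part-split : ∀ p → sumL (K p ∘ head) (comps (suc m) (suc x)) ≡ K m (suc x) + shifted p
    first-part-split p = begin
        sumL (K p ∘ head) (comps (suc m) (suc x))
      ≡⟨ sum-comps-suc (K p ∘ head) x ⟩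
        sumL (λ _ → K p 0) (comps m (suc x)) + sumL (K p ∘ head ∘ bump) (comps (suc m) x)
      ≡⟨ cong₂ _+_ (trans (sumL-const (K p 0) (comps m (suc x)))
                          (cong₂ _*_ (length-comps m (suc x)) (K-zeroʳ p)))
                   (sumL-cong (cong (K p) ∘ head-bump) (comps (suc m) x)) ⟩
        K m (suc x) * 1 + shifted p
      ≡⟨ cong (_+ shifted p) (*-identityʳ (K m (suc x))) ⟩
        K m (suc x) + shifted p ∎
      where open ≡-Reasoning

    combine : ∀ p → K m (suc x) + shifted p ≡ K (p + m) (suc x)
    combine zero    = trans (cong (K m (suc x) +_) (trans (sumL-const 0 (comps (suc m) x))
                                                          (*-zeroʳ (length (comps (suc m) x)))))
                            (+-identityʳ (K m (suc x)))
    combine (suc p) = begin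
        K m (suc x) + shifted (suc p)
      ≡⟨ cong (K m (suc x) +_) (sumL-+ (λ c → K p (suc (head c))) (K (suc p) ∘ head) (comps (suc m) x)) ⟩
        K m (suc x) + (shifted p + sumL (K (suc p) ∘ head) (comps (suc m) x))
      ≡⟨ sym (+-assoc (K m (suc x)) (shifted p) _) ⟩
        (K m (suc x) + shifted p) + sumL (K (suc p) ∘ head) (comps (suc m) x)
      ≡⟨ cong₂ _+_ (combine p) (sum-K-head (suc p) m x) ⟩
        K (p + m) (suc x) + K (suc p + m) x ∎
      where open ≡-Reasoning

sum-K-second : ∀ p m z → sumL (K p ∘ head ∘ tail) (comps (suc (suc m)) z) ≡ K (suc (p + m)) z
sum-K-second p m zero    = trans (sum-comps-zero {suc (suc m)} (K p ∘ head ∘ tail))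
                                 (trans (cong (_+ 0) (K-zeroʳ p)) (sym (K-zeroʳ (suc (p + m)))))
sum-K-second p m (suc z) = begin
    sumL (K p ∘ head ∘ tail) (comps (suc (suc m)) (suc z))
  ≡⟨ sum-comps-suc (K p ∘ head ∘ tail) z ⟩
    sumL (K p ∘ head) (comps (suc m) (suc z)) + sumL (K p ∘ head ∘ tail ∘ bump) (comps (suc (suc m)) z)
  ≡⟨ cong₂ _+_ (sum-K-head p m (suc z))
               (trans (sumL-cong (cong (K p ∘ head) ∘ tail-bump) (comps (suc (suc m)) z))
                      (sum-K-second p m z)) ⟩
    K (p + m) (suc z) + K (suc (p + m)) z ∎
  where open ≡-Reasoning

length-concatMap : ∀ {A B : Set} (f : A → List B) (xs : List A) →
                   length (concatMap f xs) ≡ sumL (length ∘ f) xs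
length-concatMap f []       = refl
length-concatMap f (x ∷ xs) = trans (length-++ (f x)) (cong (length (f x) +_) (length-concatMap f xs))

unique-concatMap : ∀ {A B : Set} (f : A → List B) (key : B → A) →
                   (∀ x {b} → b ∈ f x → key b ≡ x) → (∀ x → Unique (f x)) →
                   ∀ {xs} → Unique xs → Unique (concatMap f xs)
unique-concatMap f key key-f unique-f {xs} xs! =
  Unique.concat⁺ (ListAll.map⁺ (ListAll.tabulate (λ {x} _ → unique-f x)))
                 (AllPairs.map⁺ (AllPairs.map disjoint xs!))
  where
    disjoint : ∀ {x y} → x ≢ y → Disjoint (f x) (f y)
    disjoint {x} {y} x≢y (b∈fx , b∈fy) = x≢y (trans (sym (key-f x b∈fx)) (key-f y b∈fy))

ΣFin-cong : ∀ n {f g : Fin n → ℕ} → (∀ i → f i ≡ g i) → ΣFin n f ≡ ΣFin n g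
ΣFin-cong zero    e = refl
ΣFin-cong (suc n) e = cong₂ _+_ (e fzero) (ΣFin-cong n (e ∘ fsuc))

ΣFin-zero : ∀ n → ΣFin n (λ _ → 0) ≡ 0
ΣFin-zero zero    = refl
ΣFin-zero (suc n) = ΣFin-zero n

ΣFin-lookup : ∀ {n} (v : Vec ℕ n) → ΣFin n (lookup v) ≡ vsum v
ΣFin-lookup []      = refl
ΣFin-lookup (a ∷ v) = cong (a +_) (ΣFin-lookup v)

-- Bordered matrices: first row r, below it a zero column next to the block B.
-- Every upper-triangular matrix of size n + 1 is uniquely of this form.

border : ∀ {n} → Vec ℕ (suc n) → Matrix n → Matrix (suc n)
border r B = r ∷ Vec.map (0 ∷_) B

entry-border : ∀ {n} (r : Vec ℕ (suc n)) (B : Matrix n) i j →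
               entry (border r B) (fsuc i) (fsuc j) ≡ entry B i j
entry-border r B i j = cong (λ row → lookup row (fsuc j)) (lookup-map i (0 ∷_) B)

entry-border-column : ∀ {n} (r : Vec ℕ (suc n)) (B : Matrix n) i → entry (border r B) (fsuc i) fzero ≡ 0
entry-border-column r B i = cong (λ row → lookup row fzero) (lookup-map i (0 ∷_) B)

border-injective : ∀ {n} (r : Vec ℕ (suc n)) {B B′ : Matrix n} → border r B ≡ border r B′ → B ≡ B′
border-injective r {B} {B′} e = trans (sym (lowerBlock B)) (trans (cong (Vec.map tail ∘ tail) e) (lowerBlock B′))
  where
    lowerBlock : ∀ {m k} (C : Vec (Vec ℕ k) m) → Vec.map tail (Vec.map (0 ∷_) C) ≡ C
    lowerBlock []      = refl
    lowerBlock (c ∷ C) = cong (c ∷_) (lowerBlock C)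

border-decomposition : ∀ {n} (A : Matrix (suc n)) → UpperTriangular A →
                       A ≡ border (head A) (Vec.map tail (tail A))
border-decomposition (r ∷ rows) ut = cong (r ∷_) (zero-column rows (λ i → ut (fsuc i) fzero (s≤s z≤n)))
  where
    zero-column : ∀ {m k} (rows : Vec (Vec ℕ (suc k)) m) → (∀ i → lookup (lookup rows i) fzero ≡ 0) →
                  rows ≡ Vec.map (0 ∷_) (Vec.map tail rows)
    zero-column []               z = refl
    zero-column ((a ∷ t) ∷ rows) z with z fzero
    ... | refl = cong ((0 ∷ t) ∷_) (zero-column rows (z ∘ fsuc))

upperTriangular-border⁻ : ∀ {n} (r : Vec ℕ (suc n)) (B : Matrix n) →
                          UpperTriangular (border r B) → UpperTriangular B
upperTriangular-border⁻ r B ut i j j<i = trans (sym (entry-border r B i j)) (ut (fsuc i) (fsuc j) (s≤s j<i))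

upperTriangular-border⁺ : ∀ {n} (r : Vec ℕ (suc n)) (B : Matrix n) →
                          UpperTriangular B → UpperTriangular (border r B)
upperTriangular-border⁺ r B ut (fsuc i) fzero    _         = entry-border-column r B i
upperTriangular-border⁺ r B ut (fsuc i) (fsuc j) (s≤s j<i) = trans (entry-border r B i j) (ut i j j<i)

rowPart-border-top : ∀ {n} (r : Vec ℕ (suc n)) (B : Matrix n) → rowPart (border r B) fzero ≡ vsum r
rowPart-border-top r B = ΣFin-lookup r

colPart-border-top : ∀ {n} (r : Vec ℕ (suc n)) (B : Matrix n) → colPart (border r B) fzero ≡ 0
colPart-border-top {n} r B = ΣFin-zero (suc n)

rowPart-border : ∀ {n} (r : Vec ℕ (suc n)) (B : Matrix n) k → rowPart (border r B) (fsuc k) ≡ rowPart B k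
rowPart-border {n} r B k = ΣFin-cong n (λ j →
  cong₂ (λ b x → if b then x else 0)
        (does-⇔ (mk⇔ s≤s⁻¹ s≤s) (fsuc k ≤? fsuc j) (k ≤? j)) (entry-border r B k j))

colPart-border : ∀ {n} (r : Vec ℕ (suc n)) (B : Matrix n) k →
                 colPart (border r B) (fsuc k) ≡ lookup (tail r) k + colPart B k
colPart-border {n} (a ∷ t) B k = cong (lookup t k +_) (ΣFin-cong n (λ i →
  cong (λ x → if does (i <? k) then x else 0) (entry-border (a ∷ t) B i k)))

-- Tesler matrices with an arbitrary hook vector h: h_k = 1 for all k is the
-- case of the theorem, but the recursion below changes the hook vector.

_⊕_ : ∀ {n} → Vec ℕ n → Vec ℕ n → Vec ℕ n
_⊕_ = zipWith _+_

HookTesler : ∀ {n} → Vec ℕ n → Matrix n → Set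
HookTesler h A = UpperTriangular A × (∀ k → rowPart A k ≡ lookup h k + colPart A k)

ones : (n : ℕ) → Vec ℕ n
ones n = Vec.replicate n 1

border-hook : ∀ {n} (hs : Vec ℕ n) r (B : Matrix n) k →
              lookup hs k + colPart (border r B) (fsuc k) ≡ lookup (hs ⊕ tail r) k + colPart B k
border-hook hs r B k = begin
    lookup hs k + colPart (border r B) (fsuc k)
  ≡⟨ cong (lookup hs k +_) (colPart-border r B k) ⟩
    lookup hs k + (lookup (tail r) k + colPart B k)
  ≡⟨ sym (+-assoc (lookup hs k) _ _) ⟩
    lookup hs k + lookup (tail r) k + colPart B k
  ≡⟨ cong (_+ colPart B k) (sym (lookup-zipWith _+_ k hs (tail r))) ⟩
    lookup (hs ⊕ tail r) k + colPart B k ∎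
  where open ≡-Reasoning

hookTesler-border⁻ : ∀ {n} h₀ (hs : Vec ℕ n) r B → HookTesler (h₀ ∷ hs) (border r B) →
                     vsum r ≡ h₀ × HookTesler (hs ⊕ tail r) B
hookTesler-border⁻ h₀ hs r B (ut , hook) = top , upperTriangular-border⁻ r B ut , below
  where
    top : vsum r ≡ h₀
    top = trans (sym (rowPart-border-top r B))
                (trans (hook fzero) (trans (cong (h₀ +_) (colPart-border-top r B)) (+-identityʳ h₀)))
    below : ∀ k → rowPart B k ≡ lookup (hs ⊕ tail r) k + colPart B k
    below k = trans (sym (rowPart-border r B k)) (trans (hook (fsuc k)) (border-hook hs r B k))

hookTesler-border⁺ : ∀ {n} h₀ (hs : Vec ℕ n) r B → vsum r ≡ h₀ → HookTesler (hs ⊕ tail r) B →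
                     HookTesler (h₀ ∷ hs) (border r B)
hookTesler-border⁺ h₀ hs r B top (ut , hook) = upperTriangular-border⁺ r B ut , hook′
  where
    hook′ : ∀ k → rowPart (border r B) k ≡ lookup (h₀ ∷ hs) k + colPart (border r B) k
    hook′ fzero    = trans (rowPart-border-top r B)
                           (trans top (sym (trans (cong (h₀ +_) (colPart-border-top r B)) (+-identityʳ h₀))))
    hook′ (fsuc k) = trans (rowPart-border r B k) (trans (hook k) (sym (border-hook hs r B k)))

T : (n : ℕ) → Vec ℕ n → ℕ
T zero    []       = 1
T (suc n) (h ∷ hs) = sumL (λ r → T n (hs ⊕ tail r)) (comps (suc n) h)

teslers : (n : ℕ) → Vec ℕ n → List (Matrix n)
teslers zero    []       = [ [] ]
teslers (suc n) (h ∷ hs) = concatMap (λ r → map (border r) (teslers n (hs ⊕ tail r))) (comps (suc n) h)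

length-teslers : ∀ n h → length (teslers n h) ≡ T n h
length-teslers zero    []       = refl
length-teslers (suc n) (h ∷ hs) =
  trans (length-concatMap (λ r → map (border r) (teslers n (hs ⊕ tail r))) (comps (suc n) h))
        (sumL-cong (λ r → trans (length-map (border r) (teslers n (hs ⊕ tail r)))
                                (length-teslers n (hs ⊕ tail r)))
                   (comps (suc n) h))

teslers-sound : ∀ n (h : Vec ℕ n) {A} → A ∈ teslers n h → HookTesler h A
teslers-sound zero    []       (here refl) = (λ ()) , (λ ())
teslers-sound (suc n) (h₀ ∷ hs) A∈ with find (∈-concatMap⁻ _ {xs = comps (suc n) h₀} A∈)
... | r , r∈ , A∈′ with ∈-map⁻ (border r) A∈′
...   | B , B∈ , refl = hookTesler-border⁺ h₀ hs r B (comps-sound (suc n) h₀ r∈) (teslers-sound n (hs ⊕ tail r) B∈)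

teslers-complete : ∀ n (h : Vec ℕ n) A → HookTesler h A → A ∈ teslers n h
teslers-complete zero    []        []  _ = here refl
teslers-complete (suc n) (h₀ ∷ hs) A t = subst (_∈ teslers (suc n) (h₀ ∷ hs)) (sym A≡) bordered∈
  where
    r = head A
    B = Vec.map tail (tail A)
    A≡ : A ≡ border r B
    A≡ = border-decomposition A (proj₁ t)
    split : vsum r ≡ h₀ × HookTesler (hs ⊕ tail r) B
    split = hookTesler-border⁻ h₀ hs r B (subst (HookTesler (h₀ ∷ hs)) A≡ t)
    bordered∈ : border r B ∈ teslers (suc n) (h₀ ∷ hs)
    bordered∈ = ∈-concatMap⁺ _ (lose (comps-complete (suc n) h₀ r (proj₁ split))
                                     (∈-map⁺ (border r) (teslers-complete n _ B (proj₂ split))))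

teslers-unique : ∀ n (h : Vec ℕ n) → Unique (teslers n h)
teslers-unique zero    []        = ListAll.[] ∷ []
teslers-unique (suc n) (h₀ ∷ hs) =
  unique-concatMap _ head first-row
    (λ r → Unique.map⁺ (border-injective r) (teslers-unique n (hs ⊕ tail r)))
    (comps-unique (suc n) h₀)
  where
    first-row : ∀ r {A} → A ∈ map (border r) (teslers n (hs ⊕ tail r)) → head A ≡ r
    first-row r A∈ with ∈-map⁻ (border r) A∈
    ... | _ , _ , refl = refl

T-positive : ∀ n (h : Vec ℕ n) → 1 ≤ T n h
T-positive zero    []        = ≤-refl
T-positive (suc n) (h₀ ∷ hs) =
  ≤-trans (T-positive n (hs ⊕ tail diagonal-row))
          (sumL-≥-member (λ r → T n (hs ⊕ tail r)) (comps-complete (suc n) h₀ diagonal-row diagonal-sum))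
  where
    diagonal-row : Vec ℕ (suc n)
    diagonal-row = h₀ ∷ replicate n 0
    diagonal-sum : vsum diagonal-row ≡ h₀
    diagonal-sum = trans (cong (h₀ +_) (zeros n)) (+-identityʳ h₀)
      where
        zeros : ∀ m → vsum (replicate m 0) ≡ 0
        zeros zero    = refl
        zeros (suc m) = zeros m

-- Vectors with all entries ≥ 1; the lower bound needs the later hooks to stay positive,
-- which ⊕ preserves.
Positive : ∀ {n} → Vec ℕ n → Set
Positive = All (1 ≤_)

positive-⊕ : ∀ {n} (b c : Vec ℕ n) → Positive b → Positive (b ⊕ c)
positive-⊕ []      []      []       = []
positive-⊕ (a ∷ b) (x ∷ c) (p ∷ ps) = ≤-trans p (m≤m+n a x) ∷ positive-⊕ b c ps

positive-ones : ∀ n → Positive (ones n)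
positive-ones zero    = []
positive-ones (suc n) = s≤s z≤n ∷ positive-ones n

-- Lower bound (1·3·5···(2k+1)) · K (k+1) x ≤ T (x+1, b) for any positive b of length k + 1.
-- Step: bound each summand of the first-row recursion by induction, keep only the
-- dependence on the second part r₁ of the row, resum by the convolution identity
-- and compare K (2k+3) (x+1) with (2k+3) · K (k+2) x.
tesler-lower : ∀ k x (b : Vec ℕ (suc k)) → Positive b →
               oddProd (suc k) * K (suc k) x ≤ T (suc (suc k)) (suc x ∷ b)
tesler-lower zero    x (b₀ ∷ [])  _ = ≤-trans (≤-reflexive (trans (*-identityˡ (K 1 x)) (K-oneˡ x))) (T-positive 2 (suc x ∷ b₀ ∷ []))
tesler-lower (suc k) x (suc y ∷ b) (_ ∷ b-pos) = begin
    oddProd (suc k) * (2 * suc k + 1) * K (suc (suc k)) x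
  ≡⟨ *-assoc (oddProd (suc k)) (2 * suc k + 1) _ ⟩
    oddProd (suc k) * ((2 * suc k + 1) * K (suc (suc k)) x)
  ≤⟨ *-monoʳ-≤ (oddProd (suc k)) growth ⟩
    oddProd (suc k) * K (suc (suc k + suc k)) (suc x)
  ≡⟨ cong (oddProd (suc k) *_) (sym (sum-K-second (suc k) (suc k) (suc x))) ⟩
    oddProd (suc k) * sumL (K (suc k) ∘ head ∘ tail) rows
  ≡⟨ sym (sumL-*ˡ (oddProd (suc k)) (K (suc k) ∘ head ∘ tail) rows) ⟩
    sumL (λ r → oddProd (suc k) * K (suc k) (head (tail r))) rows
  ≤⟨ sumL-mono summand rows ⟩
    T (suc (suc (suc k))) (suc x ∷ suc y ∷ b) ∎
  where
    open ≤-Reasoning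
    rows = comps (suc (suc (suc k))) (suc x)
    growth : (2 * suc k + 1) * K (suc (suc k)) x ≤ K (suc (suc k + suc k)) (suc x)
    growth = subst (λ M → M * K (suc (suc k)) x ≤ K (suc (suc k + suc k)) (suc x)) (sym (odd k))
                   (K-comparison (suc (suc k + suc k)) (suc (suc k)) (s≤s (s≤s (m≤m+n k (suc k))))
                             (≤-reflexive (twice k)) x)
      where
        odd : ∀ k → 2 * suc k + 1 ≡ suc (suc k + suc k)
        odd = solve-∀
        twice : ∀ k → 2 * suc (suc k) ≡ suc (suc (suc k + suc k))
        twice = solve-∀
    summand : ∀ r → oddProd (suc k) * K (suc k) (head (tail r)) ≤ T (suc (suc k)) ((suc y ∷ b) ⊕ tail r)
    summand (r₀ ∷ r₁ ∷ rs) = ≤-trans (*-monoʳ-≤ (oddProd (suc k)) (K-monoʳ k r₁ y))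
                                     (tesler-lower k (y + r₁) (b ⊕ rs) (positive-⊕ b rs b-pos))

tesler-lower-ones : ∀ n → 1 ≤ n → oddProd (n ∸ 1) ≤ T n (ones n)
tesler-lower-ones (suc zero)    _ = T-positive 1 (ones 1)
tesler-lower-ones (suc (suc k)) _ =
  ≤-trans (≤-reflexive (sym (trans (cong (oddProd (suc k) *_) (K-zeroʳ (suc k))) (*-identityʳ _))))
          (tesler-lower k 0 (ones (suc k)) (positive-ones (suc k)))

weight growth : ℕ → ℕ
weight zero    = 1
weight (suc k) = suc (growth k)
growth zero    = 1
growth (suc k) = growth k + weight k

weight-positive : ∀ k → 1 ≤ weight k
weight-positive zero    = s≤s z≤n
weight-positive (suc k) = s≤s z≤n

weight-mono : ∀ k → weight k ≤ weight (suc k)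
weight-mono zero    = s≤s z≤n
weight-mono (suc k) = s≤s (m≤m+n (growth k) (weight k))

weight≤growth : ∀ k → weight (suc k) ≤ growth (suc k)
weight≤growth k = ≤-trans (≤-reflexive (+-comm 1 (growth k))) (+-monoʳ-≤ (growth k) (weight-positive k))

-- The defect D_k = A² + A + λ − Aλ − λ² (A = A_k, λ = λ_k) stays between 0 and λ_k:
-- D₀ = 1 and D_{k+1} = λ_k − D_k.  Its nonnegativity is the growth condition below.
record Balance (k : ℕ) : Set where
  field
    defect slack : ℕ
    split        : defect + slack ≡ weight k
    balanced     : growth k * growth k + growth k + weight k
                   ≡ growth k * weight k + weight k * weight k + defect

next-balanced : ∀ a p d s → d + s ≡ p → a * a + a + p ≡ a * p + p * p + d →
                (a + p) * (a + p) + (a + p) + suc a ≡ (a + p) * suc a + suc a * suc a + s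
next-balanced a p d s split balanced = +-cancelʳ-≡ (a * a + a + d) _ _ (begin
    (a + p) * (a + p) + (a + p) + suc a + (a * a + a + d)
  ≡⟨ expand a p d ⟩
    (a + p) * suc a + suc a * suc a + (a * p + p * p + d)
  ≡⟨ cong ((a + p) * suc a + suc a * suc a +_) (sym balanced) ⟩
    (a + p) * suc a + suc a * suc a + (a * a + a + p)
  ≡⟨ cong (λ t → (a + p) * suc a + suc a * suc a + (a * a + a + t)) (sym split) ⟩
    (a + p) * suc a + suc a * suc a + (a * a + a + (d + s))
  ≡⟨ regroup ((a + p) * suc a + suc a * suc a) (a * a + a) d s ⟩
    (a + p) * suc a + suc a * suc a + s + (a * a + a + d) ∎)
  where
    open ≡-Reasoning
    expand : ∀ a p d → (a + p) * (a + p) + (a + p) + suc a + (a * a + a + d)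
                       ≡ (a + p) * suc a + suc a * suc a + (a * p + p * p + d)
    expand = solve-∀
    regroup : ∀ X Y d s → X + (Y + (d + s)) ≡ X + s + (Y + d)
    regroup = solve-∀

balance : ∀ k → Balance k
balance zero    = record { defect = 1 ; slack = 0 ; split = refl ; balanced = refl }
balance (suc k) = record
  { defect   = slack
  ; slack    = suc (growth k) ∸ slack
  ; split    = m+[n∸m]≡n slack≤
  ; balanced = next-balanced (growth k) (weight k) defect slack split balanced
  }
  where
    open Balance (balance k)
    slack≤ : slack ≤ suc (growth k)
    slack≤ = ≤-trans (m≤n+m slack defect) (≤-trans (≤-reflexive split) (weight-mono k))

growth-condition : ∀ k → weight k * (growth k + growth (suc k)) ≤ growth (suc k) * weight (suc k)
growth-condition k = ≤-trans (m≤m+n _ defect) (≤-reflexive (begin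
    p * (a + (a + p)) + defect
  ≡⟨ expand a p defect ⟩
    a * p + (a * p + p * p + defect)
  ≡⟨ cong (a * p +_) (sym balanced) ⟩
    a * p + (a * a + a + p)
  ≡⟨ factor a p ⟩
    (a + p) * suc a ∎))
  where
    open Balance (balance k)
    open ≡-Reasoning
    a = growth k
    p = weight k
    expand : ∀ a p d → p * (a + (a + p)) + d ≡ a * p + (a * p + p * p + d)
    expand = solve-∀
    factor : ∀ a p → a * p + (a * a + a + p) ≡ (a + p) * suc a
    factor = solve-∀

monomial : ∀ {m} → Vec ℕ m → Vec ℕ m → ℕ
monomial []       []      = 1
monomial (w ∷ ws) (a ∷ v) = w ^ a * monomial ws v

monomial-⊕ : ∀ {m} (w u v : Vec ℕ m) → monomial w (u ⊕ v) ≡ monomial w u * monomial w v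
monomial-⊕ []       []      []      = refl
monomial-⊕ (w ∷ ws) (a ∷ u) (b ∷ v) = begin
    w ^ (a + b) * monomial ws (u ⊕ v)
  ≡⟨ cong₂ _*_ (^-distribˡ-+-* w a b) (monomial-⊕ ws u v) ⟩
    w ^ a * w ^ b * (monomial ws u * monomial ws v)
  ≡⟨ interchange (w ^ a) (w ^ b) (monomial ws u) (monomial ws v) ⟩
    w ^ a * monomial ws u * (w ^ b * monomial ws v) ∎
  where
    open ≡-Reasoning
    interchange : ∀ x y z t → x * y * (z * t) ≡ x * z * (y * t)
    interchange = solve-∀

monomial-bump : ∀ {m} (w₀ : ℕ) (ws : Vec ℕ m) (v : Vec ℕ (suc m)) →
                monomial (w₀ ∷ ws) (bump v) ≡ w₀ * monomial (w₀ ∷ ws) v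
monomial-bump w₀ ws (a ∷ v) = *-assoc w₀ (w₀ ^ a) (monomial ws v)

monomial-zeros : ∀ {m} (w : Vec ℕ m) → monomial w (replicate m 0) ≡ 1
monomial-zeros []       = refl
monomial-zeros (w ∷ ws) = trans (+-identityʳ (monomial ws (replicate _ 0))) (monomial-zeros ws)

monomial-positive : ∀ {m} (w v : Vec ℕ m) → Positive w → 1 ≤ monomial w v
monomial-positive []       []      []         = ≤-refl
monomial-positive (w ∷ ws) (a ∷ v) (1≤w ∷ ps) =
  *-mono-≤ (≤-trans (≤-reflexive (sym (^-zeroˡ a))) (^-monoˡ-≤ a 1≤w)) (monomial-positive ws v ps)

H : ∀ {m} → Vec ℕ m → ℕ → ℕ
H {m} w z = sumL (monomial w) (comps m z)

H-zero : ∀ {m} (w : Vec ℕ m) → H w 0 ≡ 1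
H-zero w = trans (sum-comps-zero (monomial w)) (trans (+-identityʳ _) (monomial-zeros w))

H-suc : ∀ {m} (w₀ : ℕ) (ws : Vec ℕ m) z → H (w₀ ∷ ws) (suc z) ≡ H ws (suc z) + w₀ * H (w₀ ∷ ws) z
H-suc {m} w₀ ws z =
  trans (sum-comps-suc (monomial (w₀ ∷ ws)) z)
        (cong₂ _+_ (sumL-cong (λ c → +-identityʳ (monomial ws c)) (comps m (suc z)))
                   (trans (sumL-cong (monomial-bump w₀ ws) (comps (suc m) z))
                          (sumL-*ˡ w₀ (monomial (w₀ ∷ ws)) (comps (suc m) z))))

-- The weight vector (λ_{m-1}, …, λ₀) and the cumulative sums
--   G m x = Σ_{z ≤ x} H (λ_{m-1}, …, λ₀) z,
-- written as a sum over the tails of the compositions of x into m + 1 parts.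
weights : (m : ℕ) → Vec ℕ m
weights zero    = []
weights (suc m) = weight m ∷ weights m

weights-positive : ∀ m → Positive (weights m)
weights-positive zero    = []
weights-positive (suc m) = weight-positive m ∷ weights-positive m

G : ℕ → ℕ → ℕ
G m x = sumL (monomial (weights m) ∘ tail) (comps (suc m) x)

G-zeroʳ : ∀ m → G m 0 ≡ 1
G-zeroʳ m = trans (sum-comps-zero {suc m} (monomial (weights m) ∘ tail))
                  (trans (+-identityʳ _) (monomial-zeros (weights m)))

G-suc : ∀ m x → G m (suc x) ≡ H (weights m) (suc x) + G m x
G-suc m x = trans (sum-comps-suc (monomial (weights m) ∘ tail) x)
                  (cong (H (weights m) (suc x) +_)
                        (sumL-cong (cong (monomial (weights m)) ∘ tail-bump) (comps (suc m) x)))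

G-zeroˡ : ∀ x → G 0 x ≡ 1
G-zeroˡ zero    = G-zeroʳ 0
G-zeroˡ (suc x) = trans (G-suc 0 x) (G-zeroˡ x)

G-rec : ∀ m y → G (suc m) (suc y) ≡ G m (suc y) + weight m * G (suc m) y
G-rec m zero = begin
    G (suc m) 1
  ≡⟨ G-suc (suc m) 0 ⟩
    H (weights (suc m)) 1 + G (suc m) 0
  ≡⟨ cong₂ _+_ (H-suc (weight m) (weights m) 0) (G-zeroʳ (suc m)) ⟩
    H (weights m) 1 + weight m * H (weights (suc m)) 0 + 1
  ≡⟨ cong (λ t → H (weights m) 1 + weight m * t + 1) (H-zero (weights (suc m))) ⟩
    H (weights m) 1 + weight m * 1 + 1
  ≡⟨ swap (H (weights m) 1) (weight m * 1) ⟩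
    H (weights m) 1 + 1 + weight m * 1
  ≡⟨ sym (cong₂ (λ s t → H (weights m) 1 + s + weight m * t) (G-zeroʳ m) (G-zeroʳ (suc m))) ⟩
    H (weights m) 1 + G m 0 + weight m * G (suc m) 0
  ≡⟨ cong (_+ weight m * G (suc m) 0) (sym (G-suc m 0)) ⟩
    G m 1 + weight m * G (suc m) 0 ∎
  where
    open ≡-Reasoning
    swap : ∀ a b → a + b + 1 ≡ a + 1 + b
    swap = solve-∀
G-rec m (suc y) = begin
    G (suc m) (suc (suc y))
  ≡⟨ G-suc (suc m) (suc y) ⟩
    H (weights (suc m)) (2 + y) + G (suc m) (suc y)
  ≡⟨ cong₂ _+_ (H-suc (weight m) (weights m) (suc y)) (G-rec m y) ⟩
    H (weights m) (2 + y) + weight m * H (weights (suc m)) (suc y) + (G m (suc y) + weight m * G (suc m) y)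
  ≡⟨ regroup (H (weights m) (2 + y)) (weight m) (H (weights (suc m)) (suc y)) (G m (suc y)) (G (suc m) y) ⟩
    (H (weights m) (2 + y) + G m (suc y)) + weight m * (H (weights (suc m)) (suc y) + G (suc m) y)
  ≡⟨ sym (cong₂ (λ s t → s + weight m * t) (G-suc m (suc y)) (G-suc (suc m) y)) ⟩
    G m (suc (suc y)) + weight m * G (suc m) (suc y) ∎
  where
    open ≡-Reasoning
    regroup : ∀ h l k g g′ → h + l * k + (g + l * g′) ≡ (h + g) + l * (k + g′)
    regroup = solve-∀

G-one : ∀ m → G m 1 ≡ growth m
G-one zero    = G-zeroˡ 1
G-one (suc m) = begin
    G (suc m) 1
  ≡⟨ G-rec m 0 ⟩
    G m 1 + weight m * G (suc m) 0
  ≡⟨ cong₂ (λ s t → s + weight m * t) (G-one m) (G-zeroʳ (suc m)) ⟩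
    growth m + weight m * 1
  ≡⟨ cong (growth m +_) (*-identityʳ (weight m)) ⟩
    growth m + weight m ∎
  where open ≡-Reasoning

G-bound : ∀ m x → weight m * G m x ≤ growth m * weight m ^ x
G-bound zero    x             = ≤-reflexive (trans (cong (1 *_) (G-zeroˡ x)) (sym (cong (1 *_) (^-zeroˡ x))))
G-bound (suc m) zero          = begin
    weight (suc m) * G (suc m) 0   ≡⟨ cong (weight (suc m) *_) (G-zeroʳ (suc m)) ⟩
    weight (suc m) * 1             ≡⟨ *-identityʳ (weight (suc m)) ⟩
    weight (suc m)                 ≤⟨ weight≤growth m ⟩
    growth (suc m)                 ≡⟨ sym (*-identityʳ (growth (suc m))) ⟩
    growth (suc m) * 1             ∎
  where open ≤-Reasoning
G-bound (suc m) (suc zero)    = ≤-reflexive (begin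
    Q * G (suc m) 1          ≡⟨ cong (Q *_) (G-one (suc m)) ⟩
    Q * growth (suc m)       ≡⟨ *-comm Q (growth (suc m)) ⟩
    growth (suc m) * Q       ≡⟨ cong (growth (suc m) *_) (sym (*-identityʳ Q)) ⟩
    growth (suc m) * Q ^ 1   ∎)
  where
    open ≡-Reasoning
    Q = weight (suc m)
G-bound (suc m) (suc (suc y)) = begin
    Q * G (suc m) (2 + y)
  ≡⟨ cong (Q *_) (G-rec m (suc y)) ⟩
    Q * (G m (2 + y) + P * G (suc m) (suc y))
  ≡⟨ distribute Q (G m (2 + y)) P (G (suc m) (suc y)) ⟩
    Q * G m (2 + y) + P * (Q * G (suc m) (suc y))
  ≤⟨ +-mono-≤ (*-monoʳ-≤ Q previous) (*-monoʳ-≤ P (G-bound (suc m) (suc y))) ⟩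
    Q * (A * (P * Q ^ y)) + P * (A′ * Q ^ suc y)
  ≡⟨ collect Q A P (Q ^ y) A′ ⟩
    (P * (A + A′)) * (Q * Q ^ y)
  ≤⟨ *-monoˡ-≤ (Q * Q ^ y) (growth-condition m) ⟩
    (A′ * Q) * (Q * Q ^ y)
  ≡⟨ *-assoc A′ Q (Q * Q ^ y) ⟩
    A′ * Q ^ (2 + y) ∎
  where
    open ≤-Reasoning
    P = weight m
    Q = weight (suc m)
    A = growth m
    A′ = growth (suc m)
    instance
      P≢0 : NonZero P
      P≢0 = >-nonZero (weight-positive m)
    -- the bound at m, divided by λ_m, with one factor λ_m raised to λ_{m+1}
    previous : G m (2 + y) ≤ A * (P * Q ^ y)
    previous = ≤-trans (*-cancelˡ-≤ P (≤-trans (G-bound m (2 + y)) (≤-reflexive (shuffle A P (P ^ y)))))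
                       (*-monoʳ-≤ A (*-monoʳ-≤ P (^-monoˡ-≤ y (weight-mono m))))
      where
        shuffle : ∀ a p q → a * (p * (p * q)) ≡ p * (a * (p * q))
        shuffle = solve-∀
    distribute : ∀ q g p g′ → q * (g + p * g′) ≡ q * g + p * (q * g′)
    distribute = solve-∀
    collect : ∀ q a p r a′ → q * (a * (p * r)) + p * (a′ * (q * r)) ≡ (p * (a + a′)) * (q * r)
    collect = solve-∀

growthProduct : ℕ → ℕ
growthProduct zero    = 1
growthProduct (suc m) = growth m * growthProduct m

-- Weighted upper bound T v · λ^(1,…,1) ≤ κ_m · λ^v (λ = weights m), by induction on m:
-- bound each term of the first-row recursion, factor out λ^b and resum with G-bound.
tesler-upper-weighted : ∀ m (v : Vec ℕ m) →
  T m v * monomial (weights m) (ones m) ≤ growthProduct m * monomial (weights m) v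
tesler-upper-weighted zero    []      = ≤-refl
tesler-upper-weighted (suc m) (x ∷ b) = begin
    T (suc m) (x ∷ b) * (P ^ 1 * Λ)
  ≡⟨ cong (λ t → T (suc m) (x ∷ b) * (t * Λ)) (*-identityʳ P) ⟩
    T (suc m) (x ∷ b) * (P * Λ)
  ≡⟨ rotate (T (suc m) (x ∷ b)) P Λ ⟩
    P * (Λ * T (suc m) (x ∷ b))
  ≤⟨ *-monoʳ-≤ P resummed ⟩
    P * (C * G m x)
  ≡⟨ rotate′ P C (G m x) ⟩
    C * (P * G m x)
  ≤⟨ *-monoʳ-≤ C (G-bound m x) ⟩
    C * (growth m * P ^ x)
  ≡⟨ reorder (growthProduct m) (monomial (weights m) b) (growth m) (P ^ x) ⟩
    growth m * growthProduct m * (P ^ x * monomial (weights m) b) ∎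
  where
    open ≤-Reasoning
    P = weight m
    Λ = monomial (weights m) (ones m)
    C = growthProduct m * monomial (weights m) b
    rows = comps (suc m) x
    summand : ∀ r → Λ * T m (b ⊕ tail r) ≤ C * monomial (weights m) (tail r)
    summand r = begin
        Λ * T m (b ⊕ tail r)
      ≡⟨ *-comm Λ _ ⟩
        T m (b ⊕ tail r) * Λ
      ≤⟨ tesler-upper-weighted m (b ⊕ tail r) ⟩
        growthProduct m * monomial (weights m) (b ⊕ tail r)
      ≡⟨ cong (growthProduct m *_) (monomial-⊕ (weights m) b (tail r)) ⟩
        growthProduct m * (monomial (weights m) b * monomial (weights m) (tail r))
      ≡⟨ sym (*-assoc (growthProduct m) _ _) ⟩
        C * monomial (weights m) (tail r) ∎
    resummed : Λ * T (suc m) (x ∷ b) ≤ C * G m x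
    resummed = begin
        Λ * T (suc m) (x ∷ b)
      ≡⟨ sym (sumL-*ˡ Λ (λ r → T m (b ⊕ tail r)) rows) ⟩
        sumL (λ r → Λ * T m (b ⊕ tail r)) rows
      ≤⟨ sumL-mono summand rows ⟩
        sumL (λ r → C * monomial (weights m) (tail r)) rows
      ≡⟨ sumL-*ˡ C (monomial (weights m) ∘ tail) rows ⟩
        C * G m x ∎
    rotate : ∀ s l L → s * (l * L) ≡ l * (L * s)
    rotate = solve-∀
    rotate′ : ∀ l c g → l * (c * g) ≡ c * (l * g)
    rotate′ = solve-∀
    reorder : ∀ k p a q → k * p * (a * q) ≡ a * k * (q * p)
    reorder = solve-∀

tesler-upper : ∀ m → T m (ones m) ≤ growthProduct m
tesler-upper m = *-cancelʳ-≤ (T m (ones m)) (growthProduct m) Λ {{>-nonZero Λ-positive}}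
                             (tesler-upper-weighted m (ones m))
  where
    Λ = monomial (weights m) (ones m)
    Λ-positive : 1 ≤ Λ
    Λ-positive = monomial-positive (weights m) (ones m) (weights-positive m)

triangle : ℕ → ℕ
triangle zero    = 0
triangle (suc m) = triangle m + suc m

triangle-double : ∀ m → triangle m * 2 ≡ suc m * m
triangle-double zero    = refl
triangle-double (suc m) = begin
    (triangle m + suc m) * 2     ≡⟨ *-distribʳ-+ 2 (triangle m) (suc m) ⟩
    triangle m * 2 + suc m * 2   ≡⟨ cong (_+ suc m * 2) (triangle-double m) ⟩
    suc m * m + suc m * 2        ≡⟨ expand m ⟩
    suc (suc m) * suc m          ∎
  where
    open ≡-Reasoning
    expand : ∀ m → suc m * m + suc m * 2 ≡ suc (suc m) * suc m
    expand = solve-∀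

binom2'-triangle : ∀ m → binom2' (3 + m) ≡ triangle m
binom2'-triangle m = begin
    binom2' (3 + m)             ≡⟨ cong (_/ 2) (abs-◃ Sign.+ (suc m * m)) ⟩
    suc m * m / 2               ≡⟨ cong (_/ 2) (sym (triangle-double m)) ⟩
    triangle m * 2 / 2          ≡⟨ m*n/n≡m (triangle m) 2 ⟩
    triangle m                  ∎
  where open ≡-Reasoning

growth-estimate : ∀ j → growth (5 + j) ≤ 24 * 2 ^ j × weight (5 + j) ≤ 16 * 2 ^ j
growth-estimate zero    = ≤ᵇ⇒≤ _ _ tt , ≤ᵇ⇒≤ _ _ tt
growth-estimate (suc j) = growth′ , weight′
  where
    open ≤-Reasoning
    P = 2 ^ j
    A≤ = proj₁ (growth-estimate j)
    λ≤ = proj₂ (growth-estimate j)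
    growth′ : growth (6 + j) ≤ 24 * (2 * P)
    growth′ = begin
        growth (5 + j) + weight (5 + j)   ≤⟨ +-mono-≤ A≤ λ≤ ⟩
        24 * P + 16 * P                   ≤⟨ m≤m+n (24 * P + 16 * P) (8 * P) ⟩
        24 * P + 16 * P + 8 * P           ≡⟨ collect P ⟩
        24 * (2 * P)                      ∎
      where
        collect : ∀ p → 24 * p + 16 * p + 8 * p ≡ 24 * (2 * p)
        collect = solve-∀
    weight′ : weight (6 + j) ≤ 16 * (2 * P)
    weight′ = begin
        suc (growth (5 + j))              ≤⟨ s≤s A≤ ⟩
        suc (24 * P)                      ≤⟨ +-monoˡ-≤ (24 * P) (m^n>0 2 j) ⟩
        P + 24 * P                        ≤⟨ m≤m+n (P + 24 * P) (7 * P) ⟩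
        P + 24 * P + 7 * P                ≡⟨ collect P ⟩
        16 * (2 * P)                      ∎
      where
        collect : ∀ p → p + 24 * p + 7 * p ≡ 16 * (2 * p)
        collect = solve-∀

growthProduct-estimate : ∀ j → 2 * growthProduct (5 + j) ≤ 2 ^ triangle (2 + j) * 3 ^ (5 + j)
growthProduct-estimate zero    = ≤ᵇ⇒≤ _ _ tt
growthProduct-estimate (suc j) = begin
    2 * (growth (5 + j) * growthProduct (5 + j))
  ≡⟨ swap (growth (5 + j)) (growthProduct (5 + j)) ⟩
    growth (5 + j) * (2 * growthProduct (5 + j))
  ≤⟨ *-mono-≤ (proj₁ (growth-estimate j)) (growthProduct-estimate j) ⟩
    24 * 2 ^ j * (2 ^ triangle (2 + j) * 3 ^ (5 + j))
  ≡⟨ regroup (2 ^ j) (2 ^ triangle (2 + j)) (3 ^ (5 + j)) ⟩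
    2 ^ triangle (2 + j) * 2 ^ (3 + j) * 3 ^ (6 + j)
  ≡⟨ cong (_* 3 ^ (6 + j)) (sym (^-distribˡ-+-* 2 (triangle (2 + j)) (3 + j))) ⟩
    2 ^ triangle (3 + j) * 3 ^ (6 + j) ∎
  where
    open ≤-Reasoning
    swap : ∀ a k → 2 * (a * k) ≡ a * (2 * k)
    swap = solve-∀
    regroup : ∀ p t s → 24 * p * (t * s) ≡ t * (2 * (2 * (2 * p))) * (3 * s)
    regroup = solve-∀

growthProduct-bound : ∀ n → 1 ≤ n → 2 * growthProduct n ≤ 2 ^ binom2' n * 3 ^ n
growthProduct-bound 1 _ = ≤ᵇ⇒≤ _ _ tt
growthProduct-bound 2 _ = ≤ᵇ⇒≤ _ _ tt
growthProduct-bound 3 _ = ≤ᵇ⇒≤ _ _ tt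
growthProduct-bound 4 _ = ≤ᵇ⇒≤ _ _ tt
growthProduct-bound (suc (suc (suc (suc (suc j))))) _ =
  subst (λ e → 2 * growthProduct (5 + j) ≤ 2 ^ e * 3 ^ (5 + j))
        (sym (binom2'-triangle (2 + j))) (growthProduct-estimate j)

hookTesler-ones⁺ : ∀ n (A : Matrix n) → IsTesler A → HookTesler (ones n) A
hookTesler-ones⁺ n A (ut , hook) = ut , λ k → trans (hook k) (cong (_+ colPart A k) (sym (lookup-replicate k 1)))

hookTesler-ones⁻ : ∀ n (A : Matrix n) → HookTesler (ones n) A → IsTesler A
hookTesler-ones⁻ n A (ut , hook) = ut , λ k → trans (hook k) (cong (_+ colPart A k) (lookup-replicate k 1))

tesler-count : ∀ n → TeslerCount n (T n (ones n))
tesler-count n = teslers n (ones n) , teslers-unique n (ones n) , members , length-teslers n (ones n)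
  where
    members : ∀ A → (A ∈ teslers n (ones n) → IsTesler A) × (IsTesler A → A ∈ teslers n (ones n))
    members A = (λ A∈ → hookTesler-ones⁻ n A (teslers-sound n (ones n) A∈))
              , (λ t → teslers-complete n (ones n) A (hookTesler-ones⁺ n A t))

mainTheorem13 : ∀ (n : ℕ) → 1 ≤ n →
    ∃[ t ] (TeslerCount n t × oddProd (n ∸ 1) ≤ t × 2 * t ≤ 2 ^ binom2' n * 3 ^ n)
mainTheorem13 n 1≤n =
  T n (ones n) , tesler-count n , tesler-lower-ones n 1≤n ,
  ≤-trans (*-monoʳ-≤ 2 (tesler-upper n)) (growthProduct-bound n 1≤n)
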